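{- Let $f : \subseteq (X_0,\delta_{X_0}) \rightrightarrows (Y_0,\delta_{Y_0})$ and $g : \subseteq (X_1,\delta_{X_1}) \rightrightarrows (Y_1,\delta_{Y_1})$ be partial multifunctions on represented spaces. Then $f \boxplus g \equiv_{\mathrm{W}} f \sqcup g$.
   Context: $\langle\cdot,\cdot\rangle$ denotes the standard computable pairing on $\omega$ and the effective join on $2^\omega$; triples are coded by iterating it; for $i<2$, $\langle i,p\rangle$ means $\langle\{i\},p\rangle$. A represented space is $(X,\delta_X)$ with $\delta_X:\subseteq2^\omega\to X$ a partial surjection; $X_0\sqcup X_1=(\{0\}\times X_0)\cup(\{1\}\times X_1)$ is represented by $\delta(\langle i,p\rangle)=\langle i,\delta_{X_i}(p)\rangle$, and $X_0\times X_1$ by $\delta(\langle p_0,p_1\rangle)=\langle\delta_{X_0}(p_0),\delta_{X_1}(p_1)\rangle$. A partial multifunction $f:\subseteq X\rightrightarrows Y$ assigns to each $x\in\operatorname{dom}(f)$ a set $f(x)\subseteq Y$. $F:\subseteq2^\omega\to2^\omega$ realizes $f:\subseteq(X,\delta_X)\rightrightarrows(Y,\delta_Y)$ ($F\vdash f$) if $\delta_YF(p)\in f\delta_X(p)$ for all $p\in\operatorname{dom}(f\delta_X)$. $f\leq_{\mathrm{W}} g$ (Weihrauch reducibility) if there are Turing functionals $\Phi,\Psi$ with $\Psi\langle\mathrm{id},G\Phi\rangle\vdash f$ for all $G\vdash g$; $\equiv_{\mathrm{W}}$ is the induced equivalence. $f\sqcup g:\subseteq X_0\sqcup X_1\rightrightarrows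 Y_0\sqcup Y_1$ is given by $(f\sqcup g)(\langle0,x\rangle)=\{0\}\times f(x)$ for $x\in\operatorname{dom}(f)$ and $(f\sqcup g)(\langle1,x\rangle)=\{1\}\times g(x)$ for $x\in\operatorname{dom}(g)$. A monotone approximation is $a\in2^\omega$ all of whose elements have the form $\langle n,s,i\rangle$ ($n,s\in\omega$, $i<2$), such that $\langle n,s,i\rangle,\langle n,t,j\rangle\in a$ implies $s=t,i=j$, and $\langle m,s,i\rangle,\langle n,t,j\rangle\in a$ with $m<n$ implies $s<t$; it is total if every $n$ has some $\langle n,s,i\rangle\in a$. $\mathrm{e}:\subseteq2^\omega\to2^\omega$ has domain the total monotone approximations and $\mathrm{e}(a)(n)=i$ iff $\langle n,s,i\rangle\in a$ for some $s$. For $(Y,\delta_Y)$, $\overline Y=Y\cup\{\infty_Y\}$ ($\infty_Y\notin Y$) is represented by $\delta_{\overline Y}(p)=\delta_Y(\mathrm{e}(p))$ if $p\in\operatorname{dom}(\mathrm{e})$ and $\mathrm{e}(p)\in\operatorname{dom}(\delta_Y)$, and $\infty_Y$ otherwise. $f\boxplus g:\subseteq X_0\sqcup X_1\rightrightarrows\overline{Y_0}\times\overline{Y_1}$ is given by $(f\boxplus g)(\langle0,x\rangle)=f(x)\times\overline{Y_1}$ for $x\in\operatorname{dom}(f)$ and $(f\boxplus g)(\langle1,x\rangle)=\overline{Y_0}\times g(x)$ for $x\in\operatorname{dom}(g)$. -}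

module Defs where

open import Data.Nat using (ℕ; zero; suc; _+_; _*_; _<_)
open import Data.Bool using (Bool; true; false)
open import Data.Fin using (Fin)
open import Data.Vec using (Vec; []; _∷_; lookup)
open import Data.Product using (Σ; _×_; _,_)
open import Data.Sum using (_⊎_; inj₁; inj₂)
open import Data.Unit using (⊤; tt)
open import Data.Empty using (⊥)
open import Relation.Nullary using (¬_)
open import Relation.Binary.PropositionalEquality using (_≡_)

-- Cantor space 2^ω, viewed also as subsets of ω (n ∈ p iff p n ≡ true)

Cantor : Set
Cantor = ℕ → Bool

_≈_ : Cantor → Cantor → Set
p ≈ q = ∀ n → p n ≡ q n

b2n : Bool → ℕ
b2n false = 0
b2n true  = 1

_==_ : ℕ → ℕ → Bool
zero  == zero  = true
zero  == suc _ = false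
suc _ == zero  = false
suc m == suc n = m == n

tri : ℕ → ℕ
tri zero    = 0
tri (suc k) = suc k + tri k

pair : ℕ → ℕ → ℕ
pair m n = tri (m + n) + n

triple : ℕ → ℕ → ℕ → ℕ
triple n s i = pair n (pair s i)

join : Cantor → Cantor → Cantor
join p q n with Data.Nat.DivMod._%_ n 2 | Data.Nat.DivMod._/_ n 2
  where import Data.Nat.DivMod
... | zero  | k = p k
... | suc _ | k = q k

evens : Cantor → Cantor
evens p n = p (2 * n)

odds : Cantor → Cantor
odds p n = p (suc (2 * n))

sing : ℕ → Cantor
sing i n = n == i

-- Turing functionals: oracle μ-recursive codes with big-step semantics

data Code : ℕ → Set where
  zeroC : ∀ {n} → Code n
  succC : Code 1
  projC : ∀ {n} → Fin n → Code n
  orcC  : Code 1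
  compC : ∀ {m n} → Code m → Vec (Code n) m → Code n
  precC : ∀ {n} → Code n → Code (suc (suc n)) → Code (suc n)
  muC   : ∀ {n} → Code (suc n) → Code n

mutual
  data Eval (o : Cantor) : ∀ {n} → Code n → Vec ℕ n → ℕ → Set where
    evZero : ∀ {n} {xs : Vec ℕ n} → Eval o zeroC xs 0
    evSucc : ∀ {x} → Eval o succC (x ∷ []) (suc x)
    evProj : ∀ {n} {i : Fin n} {xs} → Eval o (projC i) xs (lookup xs i)
    evOrc  : ∀ {x} → Eval o orcC (x ∷ []) (b2n (o x))
    evComp : ∀ {m n} {f : Code m} {gs : Vec (Code n) m} {xs ys y} →
             EvalVec o gs xs ys → Eval o f ys y → Eval o (compC f gs) xs y
    evPrec0 : ∀ {n} {g : Code n} {h : Code (suc (suc n))} {xs y} →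
              Eval o g xs y → Eval o (precC g h) (0 ∷ xs) y
    evPrecS : ∀ {n} {g : Code n} {h : Code (suc (suc n))} {xs k r y} →
              Eval o (precC g h) (k ∷ xs) r → Eval o h (k ∷ r ∷ xs) y →
              Eval o (precC g h) (suc k ∷ xs) y
    evMu   : ∀ {n} {f : Code (suc n)} {xs y} →
             Eval o f (y ∷ xs) 0 →
             (∀ z → z < y → Σ ℕ (λ k → Eval o f (z ∷ xs) (suc k))) →
             Eval o (muC f) xs y

  data EvalVec (o : Cantor) {n : ℕ} : ∀ {m} → Vec (Code n) m → Vec ℕ n → Vec ℕ m → Set where
    evNil  : ∀ {xs} → EvalVec o [] xs []
    evCons : ∀ {m} {g : Code n} {gs : Vec (Code n) m} {xs y ys} →
             Eval o g xs y → EvalVec o gs xs ys → EvalVec o (g ∷ gs) xs (y ∷ ys)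

TF : Code 1 → Cantor → Cantor → Set
TF e p q = ∀ n → Eval p e (n ∷ []) (b2n (q n))

record IsPartialFun (F : Cantor → Cantor → Set) : Set where
  field
    functional : ∀ {p q q'} → F p q → F p q' → q ≈ q'
    respects   : ∀ {p p' q q'} → p ≈ p' → q ≈ q' → F p q → F p' q'

-- Represented spaces: a carrier with a partial representation
-- δ :⊆ 2^ω → X given as a relation (δ p x means p ∈ dom δ and δ p = x).

record RepSpace : Set₁ where
  field
    Carrier : Set
    δ       : Cantor → Carrier → Set
open RepSpace public

record IsRep (X : RepSpace) : Set where
  field
    functional : ∀ {p x x'} → δ X p x → δ X p x' → x ≡ x'
    extensional : ∀ {p q x} → p ≈ q → δ X p x → δ X q x
    surjective : ∀ x → Σ Cantor (λ p → δ X p x)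

-- X₀ ⊔ X₁ with δ(⟨i,p⟩) = ⟨i, δ_{X_i}(p)⟩, where ⟨i,p⟩ = ⟨{i},p⟩
_⊔R_ : RepSpace → RepSpace → RepSpace
X₀ ⊔R X₁ = record { Carrier = Carrier X₀ ⊎ Carrier X₁ ; δ = d }
  where
  d : Cantor → Carrier X₀ ⊎ Carrier X₁ → Set
  d p (inj₁ x) = (evens p ≈ sing 0) × δ X₀ (odds p) x
  d p (inj₂ x) = (evens p ≈ sing 1) × δ X₁ (odds p) x

_×R_ : RepSpace → RepSpace → RepSpace
X₀ ×R X₁ = record { Carrier = Carrier X₀ × Carrier X₁
                  ; δ = λ { p (x₀ , x₁) → δ X₀ (evens p) x₀ × δ X₁ (odds p) x₁ } }

IsMonotoneApprox : Cantor → Set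
IsMonotoneApprox a =
  (∀ k → a k ≡ true → Σ ℕ λ n → Σ ℕ λ s → Σ Bool λ i → k ≡ triple n s (b2n i)) ×
  (∀ n s t i j → a (triple n s (b2n i)) ≡ true → a (triple n t (b2n j)) ≡ true →
     (s ≡ t) × (i ≡ j)) ×
  (∀ m n s t i j → m < n → a (triple m s (b2n i)) ≡ true →
     a (triple n t (b2n j)) ≡ true → s < t)

IsTotalApprox : Cantor → Set
IsTotalApprox a = ∀ n → Σ ℕ λ s → Σ Bool λ i → a (triple n s (b2n i)) ≡ true

-- E a q  means  a ∈ dom(e) and e(a) = q
E : Cantor → Cantor → Set
E a q = IsMonotoneApprox a × IsTotalApprox a ×
        (∀ n → Σ ℕ λ s → a (triple n s (b2n (q n))) ≡ true)

-- \overline{Y} = Y ∪ {∞_Y}  (∞_Y is inj₂ tt)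
Bar : RepSpace → RepSpace
Bar Y = record { Carrier = Carrier Y ⊎ ⊤ ; δ = d }
  where
  d : Cantor → Carrier Y ⊎ ⊤ → Set
  d p (inj₁ y) = Σ Cantor λ q → E p q × δ Y q y
  d p (inj₂ _) = ¬ (Σ Cantor λ q → E p q × Σ (Carrier Y) λ y → δ Y q y)

record Multi (X Y : RepSpace) : Set₁ where
  field
    dom : Carrier X → Set
    val : Carrier X → Carrier Y → Set
open Multi public

_⊢_ : ∀ {X Y} → (Cantor → Cantor → Set) → Multi X Y → Set
_⊢_ {X} {Y} F f = ∀ p x → δ X p x → dom f x →
  Σ Cantor λ q → F p q × Σ (Carrier Y) λ y → δ Y q y × val f x y

_≤W_ : ∀ {X₀ Y₀ X₁ Y₁} → Multi X₀ Y₀ → Multi X₁ Y₁ → Set₁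
f ≤W g = Σ (Code 1) λ Φ → Σ (Code 1) λ Ψ →
  (G : Cantor → Cantor → Set) → IsPartialFun G → G ⊢ g →
  (λ p r → Σ Cantor λ q → TF Φ p q × Σ Cantor λ s → G q s × TF Ψ (join p s) r) ⊢ f

_≡W_ : ∀ {X₀ Y₀ X₁ Y₁} → Multi X₀ Y₀ → Multi X₁ Y₁ → Set₁
f ≡W g = (f ≤W g) × (g ≤W f)

_⊔M_ : ∀ {X₀ Y₀ X₁ Y₁} → Multi X₀ Y₀ → Multi X₁ Y₁ → Multi (X₀ ⊔R X₁) (Y₀ ⊔R Y₁)
f ⊔M g = record { dom = D ; val = V }
  where
  D : _ → Set
  D (inj₁ x) = dom f x
  D (inj₂ x) = dom g x
  V : _ → _ → Set
  V (inj₁ x) (inj₁ y) = val f x y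
  V (inj₁ x) (inj₂ y) = ⊥
  V (inj₂ x) (inj₁ y) = ⊥
  V (inj₂ x) (inj₂ y) = val g x y

InBar : ∀ {A : Set} → (A → Set) → A ⊎ ⊤ → Set
InBar P (inj₁ y) = P y
InBar P (inj₂ _) = ⊥

_⊞_ : ∀ {X₀ Y₀ X₁ Y₁} → Multi X₀ Y₀ → Multi X₁ Y₁ → Multi (X₀ ⊔R X₁) (Bar Y₀ ×R Bar Y₁)
f ⊞ g = record { dom = D ; val = V }
  where
  D : _ → Set
  D (inj₁ x) = dom f x
  D (inj₂ x) = dom g x
  V : _ → _ → Set
  V (inj₁ x) (y₀ , y₁) = InBar (val f x) y₀
  V (inj₂ x) (y₀ , y₁) = InBar (val g x) y₁

module Submission where

-- Both reductions use the identity as pre-processing, so the only work is a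
-- computable post-processing Ψ that turns a name ⟨p, s⟩ (p an input name, s
-- a name of a solution of the other problem) into a name of a solution.
--
-- * f ⊞ g ≤W f ⊔ g: s names ⟨i, y⟩; output the pair of approximations
--   ⟨diag(s'), ∅⟩ if i = 0 and ⟨∅, diag(s')⟩ if i = 1, where s' is the name of
--   y inside s, diag(q) = {⟨n, n, q(n)⟩ : n ∈ ω} is a total monotone
--   approximation with e(diag(q)) = q, and the empty approximation ∅ names ∞.
-- * f ⊔ g ≤W f ⊞ g: the tag i is read off p, and s names (ȳ₀, ȳ₁) with ȳᵢ ∈ Yᵢ;
--   output ⟨i, e(a)⟩ for the i-th component a of s, where e(a) is computed
--   from a by unbounded search for the unique ⟨n, t, b⟩ ∈ a.

open import Defs
open import Data.Nat using (ℕ; zero; suc; pred; _+_; _*_; _∸_; _<_; _≤_; z≤n; s≤s)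
open import Data.Nat.Properties
open import Data.Nat.DivMod using (_%_; _/_; m*n%n≡0; m*n/n≡m; [m+kn]%n≡m%n; +-distrib-/-∣ʳ)
open import Data.Nat.Divisibility using (divides-refl)
open import Data.Bool using (Bool; true; false; not; _∨_; _∧_; if_then_else_)
open import Data.Bool.Properties using (not-involutive; ∨-zeroʳ)
open import Data.Fin using () renaming (zero to fz; suc to fs)
open import Data.Vec using ([]; _∷_)
open import Data.Product using (Σ; _×_; _,_; proj₁; proj₂)
open import Data.Sum using (_⊎_; inj₁; inj₂)
open import Data.Unit using (tt)
open import Data.Empty using (⊥-elim)
open import Relation.Nullary using (¬_)
open import Relation.Binary.PropositionalEquality
open import Relation.Binary.Definitions using (tri<; tri≈; tri>)

-- isOdd and half are defined by primitive recursion so that they are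
-- directly programmable as Turing functionals below.
isOdd : ℕ → Bool
isOdd zero    = false
isOdd (suc k) = not (isOdd k)

half : ℕ → ℕ
half zero    = zero
half (suc k) = half k + b2n (isOdd k)

2*suc : ∀ k → 2 * suc k ≡ suc (suc (2 * k))
2*suc k = cong suc (+-suc k (k + 0))

isOdd-even : ∀ k → isOdd (2 * k) ≡ false
isOdd-even zero    = refl
isOdd-even (suc k) = begin
  isOdd (2 * suc k)          ≡⟨ cong isOdd (2*suc k) ⟩
  not (not (isOdd (2 * k)))  ≡⟨ not-involutive _ ⟩
  isOdd (2 * k)              ≡⟨ isOdd-even k ⟩
  false                      ∎
  where open ≡-Reasoning

half-even : ∀ k → half (2 * k) ≡ k
half-even zero    = refl
half-even (suc k) = begin
  half (2 * suc k)                                                ≡⟨ cong half (2*suc k) ⟩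
  half (2 * k) + b2n (isOdd (2 * k)) + b2n (not (isOdd (2 * k)))
    ≡⟨ cong₂ (λ h b → h + b2n b + b2n (not b)) (half-even k) (isOdd-even k) ⟩
  k + 0 + 1                                                       ≡⟨ cong (_+ 1) (+-identityʳ k) ⟩
  k + 1                                                           ≡⟨ +-comm k 1 ⟩
  suc k                                                           ∎
  where open ≡-Reasoning

half-odd : ∀ k → half (suc (2 * k)) ≡ k
half-odd k rewrite isOdd-even k | half-even k = +-identityʳ k

-- z = 2s + i codes the pair (s, i); half and isOdd decode it
encode : ℕ → Bool → ℕ
encode s false = 2 * s
encode s true  = suc (2 * s)

half-encode : ∀ s i → half (encode s i) ≡ s
half-encode s false = half-even s
half-encode s true  = half-odd s

isOdd-encode : ∀ s i → isOdd (encode s i) ≡ i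
isOdd-encode s false = isOdd-even s
isOdd-encode s true  = cong not (isOdd-even s)

join-even : ∀ p s k → join p s (2 * k) ≡ p k
join-even p s k = at {2 * k} (trans (cong (_% 2) (*-comm 2 k)) (m*n%n≡0 k 2))
                             (trans (cong (_/ 2) (*-comm 2 k)) (m*n/n≡m k 2))
  where
  at : ∀ {n} → n % 2 ≡ 0 → n / 2 ≡ k → join p s n ≡ p k
  at {n} _ q with n % 2 | n / 2
  ... | zero | _ = cong p q

join-odd : ∀ p s k → join p s (suc (2 * k)) ≡ s k
join-odd p s k = at {suc (2 * k)} (trans (cong (λ m → suc m % 2) (*-comm 2 k)) ([m+kn]%n≡m%n 1 k 2))
                                  (trans (cong (λ m → suc m / 2) (*-comm 2 k))
                                         (trans (+-distrib-/-∣ʳ 1 {d = 2} (divides-refl k)) (m*n/n≡m k 2)))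
  where
  at : ∀ {n} → n % 2 ≡ 1 → n / 2 ≡ k → join p s n ≡ s k
  at {n} _ q with n % 2 | n / 2
  ... | suc _ | _ = cong s q

-- The join described by parity and halving, the form in which our
-- functionals produce it; its halves are a and b again.
interleave : Cantor → Cantor → Cantor
interleave a b m = if isOdd m then b (half m) else a (half m)

evens-interleave : ∀ a b → evens (interleave a b) ≈ a
evens-interleave a b k rewrite isOdd-even k | half-even k = refl

odds-interleave : ∀ a b → odds (interleave a b) ≈ b
odds-interleave a b k rewrite isOdd-even k | half-even k = cong b (+-identityʳ k)

tri-step : ∀ d n → n ≤ d → tri d + n < tri (suc d)
tri-step d n n≤d = s≤s (subst (tri d + n ≤_) (+-comm (tri d) d) (+-monoʳ-≤ (tri d) n≤d))

tri-mono : ∀ {a b} → a ≤ b → tri a ≤ tri b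
tri-mono {zero}  {b}     _         = z≤n
tri-mono {suc a} {suc b} (s≤s a≤b) = +-mono-≤ (s≤s a≤b) (tri-mono a≤b)

pair-<-diagonal : ∀ m n m' n' → m + n < m' + n' → pair m n < pair m' n'
pair-<-diagonal m n m' n' lt =
  <-≤-trans (tri-step (m + n) n (m≤n+m n m))
            (≤-trans (tri-mono lt) (m≤m+n (tri (m' + n')) n'))

pair-injective : ∀ {m n m' n'} → pair m n ≡ pair m' n' → m ≡ m' × n ≡ n'
pair-injective {m} {n} {m'} {n'} e with <-cmp (m + n) (m' + n')
... | tri< lt _ _ = ⊥-elim (<⇒≢ (pair-<-diagonal m n m' n' lt) e)
... | tri> _ _ gt = ⊥-elim (<⇒≢ (pair-<-diagonal m' n' m n gt) (sym e))
... | tri≈ _ d _  = m≡m' , n≡n'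
  where
  n≡n' : n ≡ n'
  n≡n' = +-cancelˡ-≡ (tri (m + n)) n n' (trans e (cong (λ x → tri x + n') (sym d)))
  m≡m' : m ≡ m'
  m≡m' = +-cancelʳ-≡ n m m' (trans d (cong (m' +_) (sym n≡n')))

triple-injective : ∀ {a b c a' b' c'} → triple a b c ≡ triple a' b' c' →
                   a ≡ a' × b ≡ b' × c ≡ c'
triple-injective e with pair-injective e
... | a≡a' , e' with pair-injective e'
... | b≡b' , c≡c' = a≡a' , b≡b' , c≡c'

triple-≥ : ∀ a b c → a ≤ triple a b c
triple-≥ a b c = ≤-trans (m≤m+n a (pair b c))
                   (≤-trans (tri-≥ (a + pair b c)) (m≤m+n _ (pair b c)))
  where
  tri-≥ : ∀ d → d ≤ tri d
  tri-≥ zero    = z≤n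
  tri-≥ (suc d) = m≤m+n (suc d) (tri d)

b2n-injective : ∀ {a b} → b2n a ≡ b2n b → a ≡ b
b2n-injective {false} {false} _ = refl
b2n-injective {true}  {true}  _ = refl

b2n-if : ∀ (c x y : Bool) → (if c then b2n x else b2n y) ≡ b2n (if c then x else y)
b2n-if true  _ _ = refl
b2n-if false _ _ = refl

==-sound : ∀ {a b} → (a == b) ≡ true → a ≡ b
==-sound {zero}  {zero}  _ = refl
==-sound {suc a} {suc b} e = cong suc (==-sound e)

==-refl : ∀ a → (a == a) ≡ true
==-refl zero    = refl
==-refl (suc a) = ==-refl a

==-by-monus : ∀ a b → ((a ∸ b) + (b ∸ a)) == 0 ≡ (a == b)
==-by-monus zero    zero    = refl
==-by-monus zero    (suc b) = refl
==-by-monus (suc a) zero    = refl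
==-by-monus (suc a) (suc b) = ==-by-monus a b

infixr 9 _∘₁_

variable
  o : Cantor

_∘₁_ : ∀ {n} → Code 1 → Code n → Code n
c ∘₁ d = compC c (d ∷ [])

c₂ : ∀ {n} → Code 2 → Code n → Code n → Code n
c₂ c d e = compC c (d ∷ e ∷ [])

c₃ : ∀ {n} → Code 3 → Code n → Code n → Code n → Code n
c₃ c d e h = compC c (d ∷ e ∷ h ∷ [])

P0 : ∀ {n} → Code (suc n)
P0 = projC fz

P1 : ∀ {n} → Code (suc (suc n))
P1 = projC (fs fz)

P2 : ∀ {n} → Code (suc (suc (suc n)))
P2 = projC (fs (fs fz))

S : ∀ {n} → Code n → Code n
S c = succC ∘₁ c

ev∘₁ : ∀ {n} {c : Code 1} {d : Code n} {xs a y} →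
       Eval o d xs a → Eval o c (a ∷ []) y → Eval o (c ∘₁ d) xs y
ev∘₁ ed ec = evComp (evCons ed evNil) ec

evc₂ : ∀ {n} {c : Code 2} {d e : Code n} {xs a b y} →
       Eval o d xs a → Eval o e xs b → Eval o c (a ∷ b ∷ []) y → Eval o (c₂ c d e) xs y
evc₂ ed ee ec = evComp (evCons ed (evCons ee evNil)) ec

evc₃ : ∀ {n} {c : Code 3} {d e h : Code n} {xs a b b' y} →
       Eval o d xs a → Eval o e xs b → Eval o h xs b' →
       Eval o c (a ∷ b ∷ b' ∷ []) y → Eval o (c₃ c d e h) xs y
evc₃ ed ee eh ec = evComp (evCons ed (evCons ee (evCons eh evNil))) ec

evS : ∀ {n} {c : Code n} {xs a} → Eval o c xs a → Eval o (S c) xs (suc a)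
evS ec = ev∘₁ ec evSucc

ADD : Code 2
ADD = precC P0 (S P1)

evADD : ∀ a b → Eval o ADD (a ∷ b ∷ []) (a + b)
evADD zero    b = evPrec0 evProj
evADD (suc a) b = evPrecS (evADD a b) (evS evProj)

TWICE : Code 1
TWICE = c₂ ADD P0 (c₂ ADD P0 zeroC)

evTWICE : ∀ k → Eval o TWICE (k ∷ []) (2 * k)
evTWICE k = evc₂ evProj (evc₂ evProj evZero (evADD k 0)) (evADD k (k + 0))

ODD : Code 1
ODD = S TWICE

evODD : ∀ k → Eval o ODD (k ∷ []) (suc (2 * k))
evODD k = evS (evTWICE k)

PRED : Code 1
PRED = precC zeroC P0

evPRED : ∀ m → Eval o PRED (m ∷ []) (pred m)
evPRED zero    = evPrec0 evZero
evPRED (suc m) = evPrecS (evPRED m) evProj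

-- MONUS k a = a ∸ k
MONUS : Code 2
MONUS = precC P0 (PRED ∘₁ P1)

evMONUS : ∀ k a → Eval o MONUS (k ∷ a ∷ []) (a ∸ k)
evMONUS zero    a = evPrec0 evProj
evMONUS (suc k) a = evPrecS (evMONUS k a)
  (subst (Eval _ (PRED ∘₁ P1) _) (pred[m∸n]≡m∸[1+n] a k) (ev∘₁ evProj (evPRED (a ∸ k))))

TRI : Code 1
TRI = precC zeroC (c₂ ADD (S P0) P1)

evTRI : ∀ k → Eval o TRI (k ∷ []) (tri k)
evTRI zero    = evPrec0 evZero
evTRI (suc k) = evPrecS (evTRI k) (evc₂ (evS evProj) evProj (evADD (suc k) (tri k)))

PAIR : Code 2
PAIR = c₂ ADD (TRI ∘₁ c₂ ADD P0 P1) P1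

evPAIR : ∀ m n → Eval o PAIR (m ∷ n ∷ []) (pair m n)
evPAIR m n = evc₂ (ev∘₁ (evc₂ evProj evProj (evADD m n)) (evTRI (m + n))) evProj
                  (evADD (tri (m + n)) n)

TRIPLE : Code 3
TRIPLE = c₂ PAIR P0 (c₂ PAIR P1 P2)

evTRIPLE : ∀ a b c → Eval o TRIPLE (a ∷ b ∷ c ∷ []) (triple a b c)
evTRIPLE a b c = evc₂ evProj (evc₂ evProj evProj (evPAIR b c)) (evPAIR a (pair b c))

ISZERO : Code 1
ISZERO = precC (S zeroC) zeroC

evISZERO : ∀ m → Eval o ISZERO (m ∷ []) (b2n (m == 0))
evISZERO zero    = evPrec0 (evS evZero)
evISZERO (suc m) = evPrecS (evISZERO m) evZero

evNOT : ∀ b → Eval o ISZERO (b2n b ∷ []) (b2n (not b))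
evNOT false = evISZERO 0
evNOT true  = evISZERO 1

EQ : Code 2
EQ = ISZERO ∘₁ c₂ ADD (c₂ MONUS P1 P0) (c₂ MONUS P0 P1)

evEQ : ∀ a b → Eval o EQ (a ∷ b ∷ []) (b2n (a == b))
evEQ a b = subst (Eval _ EQ (a ∷ b ∷ [])) (cong b2n (==-by-monus a b))
  (ev∘₁ (evc₂ (evc₂ evProj evProj (evMONUS b a)) (evc₂ evProj evProj (evMONUS a b)) (evADD _ _))
        (evISZERO _))

COND : Code 3
COND = precC P1 P2

evCOND : ∀ {n} {C X Y : Code n} {xs} {c : Bool} {x y} →
         Eval o C xs (b2n c) → Eval o X xs x → Eval o Y xs y →
         Eval o (c₃ COND C X Y) xs (if c then x else y)
evCOND {c = false} ec ex ey = evc₃ ec ex ey (evPrec0 evProj)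
evCOND {c = true}  ec ex ey = evc₃ ec ex ey (evPrecS (evPrec0 evProj) evProj)

OR : ∀ {n} → Code n → Code n → Code n
OR X Y = c₃ COND X (S zeroC) Y

evOR : ∀ {n} {X Y : Code n} {xs} {a b : Bool} →
       Eval o X xs (b2n a) → Eval o Y xs (b2n b) → Eval o (OR X Y) xs (b2n (a ∨ b))
evOR {a = true}  ex ey = evCOND ex (evS evZero) ey
evOR {a = false} ex ey = evCOND ex (evS evZero) ey

PAR : Code 1
PAR = precC zeroC (ISZERO ∘₁ P1)

evPAR : ∀ m → Eval o PAR (m ∷ []) (b2n (isOdd m))
evPAR zero    = evPrec0 evZero
evPAR (suc m) = evPrecS (evPAR m) (ev∘₁ evProj (evNOT (isOdd m)))

HALF : Code 1
HALF = precC zeroC (c₂ ADD P1 (PAR ∘₁ P0))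

evHALF : ∀ m → Eval o HALF (m ∷ []) (half m)
evHALF zero    = evPrec0 evZero
evHALF (suc m) = evPrecS (evHALF m) (evc₂ evProj (ev∘₁ evProj (evPAR m)) (evADD (half m) _))

TF-resp : ∀ {o c q q'} → q ≈ q' → TF c o q → TF c o q'
TF-resp {o} {c} q≈q' t k = subst (λ b → Eval o c (k ∷ []) (b2n b)) (q≈q' k) (t k)

evREAD : ∀ {c : Code 1} {π : ℕ → ℕ} → (∀ k → Eval o c (k ∷ []) (π k)) →
         TF (orcC ∘₁ c) o (λ k → o (π k))
evREAD ec k = ev∘₁ (ec k) evOrc

INTERLEAVE : Code 1 → Code 1 → Code 1
INTERLEAVE C₀ C₁ = c₃ COND PAR (C₁ ∘₁ HALF) (C₀ ∘₁ HALF)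

evINTERLEAVE : ∀ {C₀ C₁ a b} → TF C₀ o a → TF C₁ o b → TF (INTERLEAVE C₀ C₁) o (interleave a b)
evINTERLEAVE {a = a} {b} ta tb m =
  subst (Eval _ _ (m ∷ [])) (b2n-if (isOdd m) (b (half m)) (a (half m)))
    (evCOND (evPAR m) (ev∘₁ (evHALF m) (tb (half m))) (ev∘₁ (evHALF m) (ta (half m))))

GUARD : Code 1 → Code 1 → Code 1
GUARD B D = c₃ COND B D zeroC

evGUARD : ∀ {B D} {b : Bool} {a} → (∀ k → Eval o B (k ∷ []) (b2n b)) → TF D o a →
          TF (GUARD B D) o (λ k → b ∧ a k)
evGUARD {b = true}  eb ta k = evCOND (eb k) (ta k) evZero
evGUARD {b = false} eb ta k = evCOND (eb k) (ta k) evZero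

-- The diagonal approximation: every q ∈ 2^ω is e(a) for the total monotone
-- approximation a = {⟨n, n, q(n)⟩ : n ∈ ω}, and a is computable from q.

hits : Cantor → ℕ → ℕ → Bool
hits q zero    k = false
hits q (suc t) k = hits q t k ∨ (triple t t (b2n (q t)) == k)

-- since n ≤ ⟨n, n, q(n)⟩, it suffices to search n ≤ k
diagonal : Cantor → Cantor
diagonal q k = hits q (suc k) k

hits-sound : ∀ q t k → hits q t k ≡ true → Σ ℕ λ n → triple n n (b2n (q n)) ≡ k
hits-sound q (suc t) k e with hits q t k in hit
... | true  = hits-sound q t k hit
... | false = t , ==-sound e

hits-complete : ∀ q {n t} → n < t → hits q t (triple n n (b2n (q n))) ≡ true
hits-complete q {n} {suc t} (s≤s n≤t) with m≤n⇒m<n∨m≡n n≤t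
... | inj₁ n<t  rewrite hits-complete q n<t = refl
... | inj₂ refl rewrite ==-refl (triple n n (b2n (q n))) = ∨-zeroʳ _

diagonal-hit : ∀ q n → diagonal q (triple n n (b2n (q n))) ≡ true
diagonal-hit q n = hits-complete q (s≤s (triple-≥ n n _))

diagonal-entry : ∀ q {n s i} → diagonal q (triple n s (b2n i)) ≡ true → s ≡ n × i ≡ q n
diagonal-entry q {n} {s} {i} e with hits-sound q (suc (triple n s (b2n i))) _ e
... | m , e' with triple-injective {m} {m} {b2n (q m)} {n} {s} {b2n i} e'
... | refl , refl , i≡ = refl , b2n-injective (sym i≡)

E-diagonal : ∀ {a q} → a ≈ diagonal q → E a q
E-diagonal {a} {q} a≈ = (entries , unique , monotone) , total , (λ n → n , hit n)
  where
  diag : ∀ {k} → a k ≡ true → diagonal q k ≡ true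
  diag {k} e = trans (sym (a≈ k)) e
  hit : ∀ n → a (triple n n (b2n (q n))) ≡ true
  hit n = trans (a≈ _) (diagonal-hit q n)
  entries : ∀ k → a k ≡ true → Σ ℕ λ n → Σ ℕ λ s → Σ Bool λ i → k ≡ triple n s (b2n i)
  entries k e with hits-sound q (suc k) k (diag e)
  ... | n , e' = n , n , q n , sym e'
  unique : ∀ n s t i j → a (triple n s (b2n i)) ≡ true → a (triple n t (b2n j)) ≡ true →
           s ≡ t × i ≡ j
  unique n s t i j e₁ e₂ with diagonal-entry q {n} {s} {i} (diag e₁)
                             | diagonal-entry q {n} {t} {j} (diag e₂)
  ... | refl , refl | refl , refl = refl , refl
  monotone : ∀ m n s t i j → m < n → a (triple m s (b2n i)) ≡ true →
             a (triple n t (b2n j)) ≡ true → s < t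
  monotone m n s t i j m<n e₁ e₂ with diagonal-entry q {m} {s} {i} (diag e₁)
                                     | diagonal-entry q {n} {t} {j} (diag e₂)
  ... | refl , _ | refl , _ = m<n
  total : IsTotalApprox a
  total n = n , q n , hit n

empty-not-E : ∀ {a q} → (∀ k → a k ≡ false) → ¬ E a q
empty-not-E {a} a≡∅ (_ , total , _) with total 0
... | s , i , e with trans (sym (a≡∅ _)) e
... | ()

bar-name : ∀ {Y a q y} → a ≈ diagonal q → δ Y q y → δ (Bar Y) a (inj₁ y)
bar-name a≈ qy = _ , E-diagonal a≈ , qy

bar-∞ : ∀ {Y a} → (∀ k → a k ≡ false) → δ (Bar Y) a (inj₂ tt)
bar-∞ a≡∅ (_ , e , _) = empty-not-E a≡∅ e

HITS : Code 1 → Code 2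
HITS R = precC zeroC (OR P1 (c₂ EQ (c₃ TRIPLE P0 P0 (R ∘₁ P0)) P2))

evHITS : ∀ {R q} → TF R o q → ∀ t k → Eval o (HITS R) (t ∷ k ∷ []) (b2n (hits q t k))
evHITS tq zero    k = evPrec0 evZero
evHITS tq (suc t) k = evPrecS (evHITS tq t k)
  (evOR evProj (evc₂ (evc₃ evProj evProj (ev∘₁ evProj (tq t)) (evTRIPLE t t _)) evProj (evEQ _ k)))

DIAG : Code 1 → Code 1
DIAG R = c₂ (HITS R) (S P0) P0

evDIAG : ∀ {R q} → TF R o q → TF (DIAG R) o (diagonal q)
evDIAG tq k = evc₂ (evS evProj) evProj (evHITS tq (suc k) k)

LeastWitness : (ℕ → Bool) → Set
LeastWitness h = Σ ℕ λ y → h y ≡ true × (∀ z → z < y → h z ≡ false)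

least-below : (h : ℕ → Bool) (n : ℕ) → (∀ z → z < n → h z ≡ false) ⊎ LeastWitness h
least-below h zero = inj₁ (λ _ ())
least-below h (suc n) with least-below h n
... | inj₂ least = inj₂ least
... | inj₁ none with h n in hn
... | true  = inj₂ (n , hn , none)
... | false = inj₁ λ z z<1+n → split z (m≤n⇒m<n∨m≡n (≤-pred z<1+n))
  where
  split : ∀ z → z < n ⊎ z ≡ n → h z ≡ false
  split z (inj₁ z<n) = none z z<n
  split _ (inj₂ refl) = hn

least-witness : (h : ℕ → Bool) (w : ℕ) → h w ≡ true → LeastWitness h
least-witness h w hw with least-below h (suc w)
... | inj₂ least = least
... | inj₁ none with trans (sym (none w ≤-refl)) hw
... | ()

-- DECODE A searches, on input n, for the least z whose coded pair
-- (half z, isOdd z) = (s, i) has ⟨n, s, i⟩ in a, and outputs i.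
ABSENT : Code 1 → Code 2
ABSENT A = ISZERO ∘₁ A ∘₁ c₃ TRIPLE P1 (HALF ∘₁ P0) (PAR ∘₁ P0)

DECODE : Code 1 → Code 1
DECODE A = PAR ∘₁ muC (ABSENT A)

evDECODE : ∀ {o A a q} → TF A o a → E a q → TF (DECODE A) o q
evDECODE {o} {A} {a} {q} ta ((_ , unique , _) , _ , value) n =
  subst (Eval _ (DECODE A) (n ∷ [])) (cong b2n isOdd-y≡q)
    (ev∘₁ (evMu (evAbsent y-found) (λ z z<y → 0 , evAbsent (below z z<y))) (evPAR y))
  where
  entry : ℕ → Bool
  entry z = a (triple n (half z) (b2n (isOdd z)))
  evAbsent : ∀ {z b} → entry z ≡ b → Eval o (ABSENT A) (z ∷ n ∷ []) (b2n (not b))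
  evAbsent {z} refl = ev∘₁ (ev∘₁ (evc₃ evProj (ev∘₁ evProj (evHALF z)) (ev∘₁ evProj (evPAR z))
                                      (evTRIPLE n _ _)) (ta _)) (evNOT _)
  s₀ : ℕ
  s₀ = proj₁ (value n)
  witness : entry (encode s₀ (q n)) ≡ true
  witness = subst₂ (λ s i → a (triple n s (b2n i)) ≡ true)
                   (sym (half-encode s₀ (q n))) (sym (isOdd-encode s₀ (q n))) (proj₂ (value n))
  least : LeastWitness entry
  least = least-witness entry (encode s₀ (q n)) witness
  y : ℕ
  y = proj₁ least
  y-found : entry y ≡ true
  y-found = proj₁ (proj₂ least)
  below : ∀ z → z < y → entry z ≡ false
  below = proj₂ (proj₂ least)
  -- a has only one entry at position n
  isOdd-y≡q : isOdd y ≡ q n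
  isOdd-y≡q = proj₂ (unique n (half y) s₀ (isOdd y) (q n) y-found (proj₂ (value n)))

PostProcesses : ∀ {X Y Z} → Code 1 → Multi X Y → Multi X Z → Set
PostProcesses {X} {Y} {Z} Ψ f g = ∀ p s {x z} → δ X p x → dom f x → δ Z s z → val g x z →
  Σ Cantor λ r → TF Ψ (join p s) r × Σ (Carrier Y) λ y → δ Y r y × val f x y

reduction-by-post-processing : ∀ {X Y Z} {f : Multi X Y} {g : Multi X Z} (Ψ : Code 1) →
  (∀ x → dom f x → dom g x) → PostProcesses Ψ f g → f ≤W g
reduction-by-post-processing Ψ dom⊆ post =
  orcC , Ψ , λ G _ G⊢g p x px fx →
    let (s , Gps , z , sz , gz) = G⊢g p x px (dom⊆ x fx)
        (r , Ψr , y , ry , fy)  = post p s px fx sz gz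
    in r , (p , (λ _ → evOrc) , s , Gps , Ψr) , y , ry , fy

sides : Bool → Cantor → Cantor
sides b d = interleave (λ k → b ∧ d k) (λ k → not b ∧ d k)

sides-true : ∀ {b} d → b ≡ true → evens (sides b d) ≈ d × (∀ k → odds (sides b d) k ≡ false)
sides-true d refl = evens-interleave d (λ _ → false) , odds-interleave d (λ _ → false)

sides-false : ∀ {b} d → b ≡ false → (∀ k → evens (sides b d) k ≡ false) × odds (sides b d) ≈ d
sides-false d refl = evens-interleave (λ _ → false) d , odds-interleave (λ _ → false) d

-- on ⟨p, s⟩ with s a name of ⟨i, y⟩: the tag bit s(0) (true iff i = 0) ...
SOLUTION-TAG : Code 1
SOLUTION-TAG = orcC ∘₁ S zeroC

-- ... and the name odds s of y
SOLUTION-NAME : Code 1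
SOLUTION-NAME = orcC ∘₁ ODD ∘₁ ODD

Ψ⊞ : Code 1
Ψ⊞ = INTERLEAVE (GUARD SOLUTION-TAG (DIAG SOLUTION-NAME)) (GUARD (ISZERO ∘₁ SOLUTION-TAG) (DIAG SOLUTION-NAME))

evΨ⊞ : ∀ p s → TF Ψ⊞ (join p s) (sides (s 0) (diagonal (odds s)))
evΨ⊞ p s = evINTERLEAVE (evGUARD tag (evDIAG solution)) (evGUARD ¬tag (evDIAG solution))
  where
  tag : ∀ k → Eval (join p s) SOLUTION-TAG (k ∷ []) (b2n (s 0))
  tag k = subst (λ b → Eval (join p s) SOLUTION-TAG (k ∷ []) (b2n b)) (join-odd p s 0) (ev∘₁ (evS evZero) evOrc)
  ¬tag : ∀ k → Eval (join p s) (ISZERO ∘₁ SOLUTION-TAG) (k ∷ []) (b2n (not (s 0)))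
  ¬tag k = ev∘₁ (tag k) (evNOT (s 0))
  solution : TF SOLUTION-NAME (join p s) (odds s)
  solution = TF-resp (λ k → join-odd p s (suc (2 * k)))
                     (evREAD (λ k → ev∘₁ (evODD k) (evODD _)))

-- this direction needs no assumption on the spaces
boxplus≤sum : ∀ {X₀ Y₀ X₁ Y₁} (f : Multi X₀ Y₀) (g : Multi X₁ Y₁) → (f ⊞ g) ≤W (f ⊔M g)
boxplus≤sum {Y₀ = Y₀} {Y₁ = Y₁} f g = reduction-by-post-processing Ψ⊞ same-domain post
  where
  same-domain : ∀ x → dom (f ⊞ g) x → dom (f ⊔M g) x
  same-domain (inj₁ _) fx = fx
  same-domain (inj₂ _) gx = gx
  post : PostProcesses Ψ⊞ (f ⊞ g) (f ⊔M g)
  post p s {inj₁ _} {inj₁ y} _ _ (tag , sy) fy =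
    let (left , right) = sides-true (diagonal (odds s)) (tag 0)
    in _ , evΨ⊞ p s , (inj₁ y , inj₂ tt) , (bar-name {Y₀} left sy , bar-∞ right) , fy
  post p s {inj₂ _} {inj₂ y} _ _ (tag , sy) gy =
    let (left , right) = sides-false (diagonal (odds s)) (tag 0)
    in _ , evΨ⊞ p s , (inj₂ tt , inj₁ y) , (bar-∞ left , bar-name {Y₁} right sy) , gy
  post p s {inj₁ _} {inj₂ _} _ _ _ ()
  post p s {inj₂ _} {inj₁ _} _ _ _ ()

-- the name ⟨i, q⟩, where i = 0 if b holds and i = 1 otherwise
tagged : Bool → Cantor → Cantor
tagged b q = interleave (sing (b2n (not b))) q

component : Bool → Cantor → Cantor
component b s k = s (if b then 2 * k else suc (2 * k))

-- on ⟨p, s⟩ with p a name of ⟨i, x⟩: the name of the singleton {i}, using p(0) = (i = 0) ...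
INPUT-TAG : Code 1
INPUT-TAG = c₂ EQ P0 (ISZERO ∘₁ orcC ∘₁ zeroC)

-- ... and the i-th component of s
COMPONENT : Code 1
COMPONENT = orcC ∘₁ ODD ∘₁ c₃ COND (orcC ∘₁ zeroC) TWICE ODD

Ψ⊔ : Code 1
Ψ⊔ = INTERLEAVE INPUT-TAG (DECODE COMPONENT)

evΨ⊔ : ∀ {p s q} b → p 0 ≡ b → E (component b s) q → TF Ψ⊔ (join p s) (tagged b q)
evΨ⊔ {p} {s} b p0≡b e = evINTERLEAVE tag (evDECODE selected e)
  where
  o0≡b : join p s 0 ≡ b
  o0≡b = trans (join-even p s 0) p0≡b
  tag : TF INPUT-TAG (join p s) (sing (b2n (not b)))
  tag k = subst (λ c → Eval (join p s) INPUT-TAG (k ∷ []) (b2n (k == b2n (not c)))) o0≡b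
                (evc₂ evProj (ev∘₁ (ev∘₁ evZero evOrc) (evNOT _)) (evEQ _ _))
  selected : TF COMPONENT (join p s) (component b s)
  selected = TF-resp (λ k → trans (join-odd p s _) (cong (λ c → s (if c then 2 * k else suc (2 * k))) o0≡b))
                     (evREAD (λ k → ev∘₁ (evCOND (ev∘₁ evZero evOrc) (evTWICE k) (evODD k)) (evODD _)))

-- δ_{Yᵢ} must be extensional, since Ψ⊔ produces the name of y only up to ≈
sum≤boxplus : ∀ {X₀ Y₀ X₁ Y₁} → IsRep Y₀ → IsRep Y₁ → (f : Multi X₀ Y₀) (g : Multi X₁ Y₁) →
              (f ⊔M g) ≤W (f ⊞ g)
sum≤boxplus {Y₀ = Y₀} {Y₁ = Y₁} rY₀ rY₁ f g = reduction-by-post-processing Ψ⊔ same-domain post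
  where
  open IsRep
  same-domain : ∀ x → dom (f ⊔M g) x → dom (f ⊞ g) x
  same-domain (inj₁ _) fx = fx
  same-domain (inj₂ _) gx = gx
  post : PostProcesses Ψ⊔ (f ⊔M g) (f ⊞ g)
  post p s {inj₁ _} {inj₁ y , _} (tag , _) _ ((q , e , qy) , _) fy =
    tagged true q , evΨ⊔ true (tag 0) e , inj₁ y ,
    (evens-interleave (sing 0) q , extensional rY₀ (λ k → sym (odds-interleave (sing 0) q k)) qy) , fy
  post p s {inj₂ _} {_ , inj₁ y} (tag , _) _ (_ , (q , e , qy)) gy =
    tagged false q , evΨ⊔ false (tag 0) e , inj₂ y ,
    (evens-interleave (sing 1) q , extensional rY₁ (λ k → sym (odds-interleave (sing 1) q k)) qy) , gy
  post p s {inj₁ _} {inj₂ _ , _} _ _ _ ()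
  post p s {inj₂ _} {_ , inj₂ _} _ _ _ ()

proposition3p12 : (X₀ Y₀ X₁ Y₁ : RepSpace) →
    IsRep X₀ → IsRep Y₀ → IsRep X₁ → IsRep Y₁ →
    (f : Multi X₀ Y₀) (g : Multi X₁ Y₁) →
    (f ⊞ g) ≡W (f ⊔M g)
proposition3p12 X₀ Y₀ X₁ Y₁ _ rY₀ _ rY₁ f g = boxplus≤sum f g , sum≤boxplus rY₀ rY₁ f g
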